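{- (1) Let $\nu_1,\nu_2,j_1,j_2\ge1$ and $m_1,m_2\ge0$. If $T_\rho(\nu_1,m_1,j_1)\sim T_\rho(\nu_2,m_2,j_2)$ and $j_1>1$, then $(\nu_1,m_1,j_1)=(\nu_2,m_2,j_2)$. (2) Let $\nu_1,\nu_2,j_1,j_2\ge1$ and $m_1,m_2\ge0$ with $\nu_i$ dividing $m_i$ for $i=1,2$. If $T_\tau(\nu_1,m_1,j_1)\sim T_\tau(\nu_2,m_2,j_2)$, then $(\nu_1,m_1,j_1)=(\nu_2,m_2,j_2)$.
   Context: Alphabet $\Sigma=\mathbb{N}$; words are finite sequences over $\Sigma$, $|w|$ is length, $w^R$ the reverse. An equivalence map is a morphism of $\Sigma^*$ induced by a bijection $\Sigma\to\Sigma$; $x\sim y$ means $f(x)=y$ for some equivalence map $f$. A double occurrence word (DOW) is a word in which every symbol occurs zero or exactly two times. A word is in ascending order if it is empty or its first symbol is $1$ and the first occurrence of each symbol is one greater than the largest symbol preceding it. Insertions: for a DOW $w$ in ascending order with largest symbol $M$ ($M=0$ if $w$ is empty), $\nu\ge1$, $u=(M+1)\cdots(M+\nu)$ and $1\le k\le\ell\le|w|+1$, write $w=y_1y_2y_3$ with $|y_1|=k-1$, $|y_1y_2|=\ell-1$; $w\star\rho(\nu,k,\ell)=y_1uy_2uy_3$ and $w\star\tau(\nu,k,\ell)=y_1uy_2u^Ry_3$. For $h,\nu\ge1$ let $x_i=((i-1)\nu+1)\cdots(i\nu)$; $\mathrm{Int}(h,\nu)=x_1\cdots x_hx_1^R\cdots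 x_h^R$. Tangled cords: for $m\ge0$, $\nu,j\ge1$, let $s_0=12\cdots m12\cdots m$ ($\epsilon$ if $m=0$), $s_j=s_{j-1}\star\rho(\nu,|s_{j-1}|-m+1,|s_{j-1}|+1)$, $T_\rho(\nu,m,j)=s_j$. If $\nu\mid m$, let $t_0=\mathrm{Int}(m/\nu,\nu)$ ($\epsilon$ if $m=0$), $t_j=t_{j-1}\star\tau(\nu,|t_{j-1}|-m+1,|t_{j-1}|+1)$, $T_\tau(\nu,m,j)=t_j$. -}

module Defs where

open import Data.Nat using (ℕ; zero; suc; _+_; _*_; _∸_; _⊔_; NonZero)
open import Data.Nat.DivMod using (_/_)
open import Data.List using (List; []; _∷_; _++_; take; drop; length; map; reverse; foldr; concat)
open import Data.Product using (Σ; _×_)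
open import Function.Bundles using (Bijection)
open import Relation.Binary.PropositionalEquality using (_≡_; setoid)

Word : Set
Word = List ℕ

_∼_ : Word → Word → Set
x ∼ y = Σ (Bijection (setoid ℕ) (setoid ℕ)) λ f → map (Bijection.to f) x ≡ y

maxSym : Word → ℕ
maxSym = foldr _⊔_ 0

block : ℕ → ℕ → Word
block a zero = []
block a (suc ν) = suc a ∷ block (suc a) ν

-- w = y₁y₂y₃ with |y₁| = k-1, |y₁y₂| = ℓ-1
y₁ y₂ y₃ : Word → ℕ → ℕ → Word
y₁ w k ℓ = take (k ∸ 1) w
y₂ w k ℓ = take ((ℓ ∸ 1) ∸ (k ∸ 1)) (drop (k ∸ 1) w)
y₃ w k ℓ = drop (ℓ ∸ 1) w

insρ : Word → ℕ → ℕ → ℕ → Word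
insρ w ν k ℓ = y₁ w k ℓ ++ u ++ y₂ w k ℓ ++ u ++ y₃ w k ℓ
  where u = block (maxSym w) ν

insτ : Word → ℕ → ℕ → ℕ → Word
insτ w ν k ℓ = y₁ w k ℓ ++ u ++ y₂ w k ℓ ++ reverse u ++ y₃ w k ℓ
  where u = block (maxSym w) ν

blocksFrom : ℕ → ℕ → ℕ → List Word
blocksFrom a zero ν = []
blocksFrom a (suc h) ν = block a ν ∷ blocksFrom (a + ν) h ν

Int : ℕ → ℕ → Word
Int h ν = concat xs ++ concat (map reverse xs)
  where xs = blocksFrom 0 h ν

sρ : ℕ → ℕ → ℕ → Word
sρ ν m zero = block 0 m ++ block 0 m
sρ ν m (suc j) = insρ s ν ((length s ∸ m) + 1) (length s + 1)
  where s = sρ ν m j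

Tρ : ℕ → ℕ → ℕ → Word
Tρ = sρ

-- T_τ(ν,m,j)  (meaningful when ν ∣ m)
tτ : (ν : ℕ) → .{{NonZero ν}} → ℕ → ℕ → Word
tτ ν m zero = Int (m / ν) ν
tτ ν m (suc j) = insτ t ν ((length t ∸ m) + 1) (length t + 1)
  where t = tτ ν m j

Tτ : (ν : ℕ) → .{{NonZero ν}} → ℕ → ℕ → Word
Tτ = tτ

-- Both families iterate a tail insertion w ↦ take n w ++ u ++ drop n w ++ u′ with n = |w| − m.
-- Since n only grows, a prefix of length at most |w| − m survives every later insertion. Hence
-- T_ρ(ν,m,j) begins with 1⋯F 1⋯ν (F = m + ν), followed by the fresh letter F+1 once j ≥ 2, and
-- T_τ(ν,m,j) begins with 1⋯F ν. A letterwise bijection between two such words fixes the initial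
-- run 1⋯, so it preserves the position of the first repeated letter, which determines F (and ν
-- for τ), and for ρ the position of the fresh letter after the repeat, which determines ν.
-- The lengths |T(ν,m,j)| = 2(m + jν) then determine m and j.
module Submission where

open import Defs
open import Data.Empty using (⊥-elim)
open import Data.List using (List; []; _∷_; _++_; take; drop; length; map; reverse; concat)
open import Data.List.Properties
  using (++-assoc; ++-identityʳ; length-++; length-map; length-reverse; length-drop;
         take-all; drop-all; take++drop≡id; ∷-injective; unfold-reverse; reverse-++)
open import Data.Nat using (ℕ; zero; suc; _+_; _*_; _∸_; _⊔_; _≤_; _<_; _≤′_; ≤′-refl; ≤′-step;
                            z≤n; s≤s; z<s; NonZero; >-nonZero⁻¹)
open import Data.Nat.Properties
open import Data.Nat.DivMod using (m*n/n≡m)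
open import Data.Nat.Divisibility using (_∣_; divides)
open import Data.Nat.Tactic.RingSolver using (solve-∀)
open import Data.Product using (∃; _×_; _,_; proj₁; proj₂)
open import Data.Sum using ([_,_]′)
open import Function.Base using (id)
open import Function.Bundles using (Bijection)
open import Relation.Binary.Definitions using (tri<; tri≈; tri>)
open import Relation.Binary.PropositionalEquality

open ≡-Reasoning

take-length-++ : ∀ {A : Set} (xs ys : List A) → take (length xs) (xs ++ ys) ≡ xs
take-length-++ []       ys = refl
take-length-++ (x ∷ xs) ys = cong (x ∷_) (take-length-++ xs ys)

drop-length-++ : ∀ {A : Set} (xs ys : List A) → drop (length xs) (xs ++ ys) ≡ ys
drop-length-++ []       ys = refl
drop-length-++ (x ∷ xs) ys = drop-length-++ xs ys

take-++-≥ : ∀ {A : Set} (xs ys : List A) {n} → length xs ≤ n →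
  take n (xs ++ ys) ≡ xs ++ take (n ∸ length xs) ys
take-++-≥ []       ys _        = refl
take-++-≥ (x ∷ xs) ys (s≤s le) = cong (x ∷_) (take-++-≥ xs ys le)

length-block : ∀ a n → length (block a n) ≡ n
length-block a zero    = refl
length-block a (suc n) = cong suc (length-block (suc a) n)

block-++ : ∀ a n k → block a n ++ block (a + n) k ≡ block a (n + k)
block-++ a zero    k rewrite +-identityʳ a = refl
block-++ a (suc n) k rewrite +-suc a n     = cong (suc a ∷_) (block-++ (suc a) n k)

block-∷ʳ : ∀ a n → block a (suc n) ≡ block a n ++ suc (a + n) ∷ []
block-∷ʳ a n = trans (cong (block a) (+-comm 1 n)) (sym (block-++ a n 1))

block-+-comm : ∀ m ν → block 0 (m + ν) ≡ block 0 ν ++ block ν m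
block-+-comm m ν = trans (cong (block 0) (+-comm m ν)) (sym (block-++ 0 ν m))

block-nonempty : ∀ a n .{{_ : NonZero n}} → ∃ λ r → block a n ≡ suc a ∷ r
block-nonempty a (suc n) = block (suc a) n , refl

block-++-split : ∀ {n₁ n₂} → n₁ < n₂ → ∀ ys → ∃ λ r → block 0 n₂ ++ ys ≡ block 0 n₁ ++ suc n₁ ∷ r
block-++-split {n₁} n₁<n₂ ys with m≤n⇒∃[o]m+o≡n n₁<n₂
... | k , refl = block (suc n₁) k ++ ys , (begin
  block 0 (suc n₁ + k) ++ ys                               ≡⟨ cong (_++ ys) (sym (block-++ 0 (suc n₁) k)) ⟩
  (block 0 (suc n₁) ++ block (suc n₁) k) ++ ys             ≡⟨ cong (λ b → (b ++ block (suc n₁) k) ++ ys) (block-∷ʳ 0 n₁) ⟩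
  ((block 0 n₁ ++ suc n₁ ∷ []) ++ block (suc n₁) k) ++ ys  ≡⟨ ++-assoc _ (block (suc n₁) k) ys ⟩
  (block 0 n₁ ++ suc n₁ ∷ []) ++ block (suc n₁) k ++ ys    ≡⟨ ++-assoc (block 0 n₁) _ _ ⟩
  block 0 n₁ ++ suc n₁ ∷ block (suc n₁) k ++ ys            ∎)

reverse-block-suc : ∀ a n → reverse (block a (suc n)) ≡ suc (a + n) ∷ reverse (block a n)
reverse-block-suc a n = trans (cong reverse (block-∷ʳ a n)) (reverse-++ (block a n) _)

maxSym-++ : ∀ xs ys → maxSym (xs ++ ys) ≡ maxSym xs ⊔ maxSym ys
maxSym-++ []       ys = refl
maxSym-++ (x ∷ xs) ys = trans (cong (x ⊔_) (maxSym-++ xs ys)) (sym (⊔-assoc x _ _))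

maxSym-reverse : ∀ xs → maxSym (reverse xs) ≡ maxSym xs
maxSym-reverse []       = refl
maxSym-reverse (x ∷ xs) = begin
  maxSym (reverse (x ∷ xs))      ≡⟨ cong maxSym (unfold-reverse x xs) ⟩
  maxSym (reverse xs ++ x ∷ [])  ≡⟨ maxSym-++ (reverse xs) _ ⟩
  maxSym (reverse xs) ⊔ (x ⊔ 0)  ≡⟨ cong₂ _⊔_ (maxSym-reverse xs) (⊔-identityʳ x) ⟩
  maxSym xs ⊔ x                  ≡⟨ ⊔-comm _ x ⟩
  maxSym (x ∷ xs)                ∎

maxSym-block : ∀ n → maxSym (block 0 n) ≡ n
maxSym-block zero    = refl
maxSym-block (suc n) = begin
  maxSym (block 0 (suc n))            ≡⟨ cong maxSym (block-∷ʳ 0 n) ⟩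
  maxSym (block 0 n ++ suc n ∷ [])    ≡⟨ maxSym-++ (block 0 n) _ ⟩
  maxSym (block 0 n) ⊔ (suc n ⊔ 0)    ≡⟨ cong₂ _⊔_ (maxSym-block n) (⊔-identityʳ (suc n)) ⟩
  n ⊔ suc n                           ≡⟨ m≤n⇒m⊔n≡n (n≤1+n n) ⟩
  suc n                               ∎

maxSym-block-++-block : ∀ n → maxSym (block 0 n ++ block 0 n) ≡ n
maxSym-block-++-block n =
  trans (maxSym-++ (block 0 n) _) (trans (cong₂ _⊔_ (maxSym-block n) (maxSym-block n)) (⊔-idem n))

length-block-++-block : ∀ a b → length (block 0 a ++ block 0 b) ≡ a + b
length-block-++-block a b = trans (length-++ (block 0 a)) (cong₂ _+_ (length-block 0 a) (length-block 0 b))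

concat-blocksFrom : ∀ a h ν → concat (blocksFrom a h ν) ≡ block a (h * ν)
concat-blocksFrom a zero    ν = refl
concat-blocksFrom a (suc h) ν =
  trans (cong (block a ν ++_) (concat-blocksFrom (a + ν) h ν)) (block-++ a ν (h * ν))

length-concat-map-reverse : ∀ (xss : List Word) → length (concat (map reverse xss)) ≡ length (concat xss)
length-concat-map-reverse []         = refl
length-concat-map-reverse (xs ∷ xss) = begin
  length (reverse xs ++ concat (map reverse xss))          ≡⟨ length-++ (reverse xs) ⟩
  length (reverse xs) + length (concat (map reverse xss))  ≡⟨ cong₂ _+_ (length-reverse xs) (length-concat-map-reverse xss) ⟩
  length xs + length (concat xss)                          ≡⟨ length-++ xs ⟨
  length (xs ++ concat xss)                                ∎

maxSym-concat-map-reverse : ∀ (xss : List Word) → maxSym (concat (map reverse xss)) ≡ maxSym (concat xss)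
maxSym-concat-map-reverse []         = refl
maxSym-concat-map-reverse (xs ∷ xss) = begin
  maxSym (reverse xs ++ concat (map reverse xss))          ≡⟨ maxSym-++ (reverse xs) _ ⟩
  maxSym (reverse xs) ⊔ maxSym (concat (map reverse xss))  ≡⟨ cong₂ _⊔_ (maxSym-reverse xs) (maxSym-concat-map-reverse xss) ⟩
  maxSym xs ⊔ maxSym (concat xss)                          ≡⟨ maxSym-++ xs _ ⟨
  maxSym (xs ++ concat xss)                                ∎

map-++-prefix : ∀ (f : ℕ → ℕ) xs {ys zs} → map f (xs ++ ys) ≡ xs ++ zs → map f xs ≡ xs × map f ys ≡ zs
map-++-prefix f []       eq = refl , eq
map-++-prefix f (x ∷ xs) eq with ∷-injective eq
... | fx≡x , eq′ with map-++-prefix f xs eq′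
...   | fxs≡xs , rest = cong₂ _∷_ fx≡x fxs≡xs , rest

map-block-∷ : ∀ (f : ℕ → ℕ) n {x y r₁ r₂} → map f (block 0 n ++ x ∷ r₁) ≡ block 0 n ++ y ∷ r₂ →
  map f (block 0 n) ≡ block 0 n × f x ≡ y
map-block-∷ f n eq with map-++-prefix f (block 0 n) eq
... | fixed , eq′ = fixed , proj₁ (∷-injective eq′)

map-block-fixes : ∀ (f : ℕ → ℕ) {n i} → map f (block 0 n) ≡ block 0 n → 0 < i → i ≤ n → f i ≡ i
map-block-fixes f {i = suc i} fixed _ i<n with block-++-split i<n []
... | _ , split = proj₂ (map-block-∷ f i (subst (λ w → map f w ≡ w) (trans (sym (++-identityʳ _)) split) fixed))

map-≡⇒length-≡ : ∀ (f : ℕ → ℕ) {xs ys} → map f xs ≡ ys → length xs ≡ length ys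
map-≡⇒length-≡ f {xs} eq = trans (sym (length-map f xs)) (cong length eq)

module _ {f : ℕ → ℕ} (f-injective : ∀ {x y} → f x ≡ f y → x ≡ y) where

  block-then-repeat-unique : ∀ {n₁ n₂ a₁ a₂ r₁ r₂} → 0 < a₁ → a₁ ≤ n₁ → 0 < a₂ → a₂ ≤ n₂ →
    map f (block 0 n₁ ++ a₁ ∷ r₁) ≡ block 0 n₂ ++ a₂ ∷ r₂ → n₁ ≡ n₂ × a₁ ≡ a₂
  block-then-repeat-unique {n₁} {n₂} {a₁} {a₂} {r₁} {r₂} 0<a₁ a₁≤n₁ 0<a₂ a₂≤n₂ eq with <-cmp n₁ n₂
  ... | tri< n₁<n₂ _ _ =
    let _ , split = block-++-split n₁<n₂ (a₂ ∷ r₂)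
        fixed , fa₁≡ = map-block-∷ f n₁ (trans eq split)
        a₁≡ = trans (sym (map-block-fixes f fixed 0<a₁ a₁≤n₁)) fa₁≡
    in ⊥-elim (1+n≰n (subst (_≤ n₁) a₁≡ a₁≤n₁))
  ... | tri≈ _ refl _ =
    let fixed , fa₁≡ = map-block-∷ f n₁ eq
    in refl , trans (sym (map-block-fixes f fixed 0<a₁ a₁≤n₁)) fa₁≡
  ... | tri> _ _ n₂<n₁ =
    let _ , split = block-++-split n₂<n₁ (a₁ ∷ r₁)
        fixed , fn₂≡ = map-block-∷ f n₂ (trans (cong (map f) (sym split)) eq)
        a₂≡ = f-injective (trans (map-block-fixes f fixed 0<a₂ a₂≤n₂) (sym fn₂≡))
    in ⊥-elim (1+n≰n (subst (_≤ n₂) a₂≡ a₂≤n₂))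

  block-then-fresh-unique : ∀ {F₁ F₂ ν₁ ν₂ x₁ x₂ r₁ r₂} → F₁ ≡ F₂ → ν₁ ≤ F₁ → ν₂ ≤ F₂ → F₁ < x₁ → F₂ < x₂ →
    map f (block 0 F₁ ++ block 0 ν₁ ++ x₁ ∷ r₁) ≡ block 0 F₂ ++ block 0 ν₂ ++ x₂ ∷ r₂ → ν₁ ≡ ν₂
  block-then-fresh-unique {F} {_} {ν₁} {ν₂} {x₁} {x₂} {r₁} {r₂} refl ν₁≤F ν₂≤F F<x₁ F<x₂ eq
    with map-++-prefix f (block 0 F) eq | <-cmp ν₁ ν₂
  ... | fixed , eq′ | tri< ν₁<ν₂ _ _ =
    let _ , split = block-++-split ν₁<ν₂ (x₂ ∷ r₂)
        _ , fx₁≡ = map-block-∷ f ν₁ (trans eq′ split)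
        ν₁<F = <-≤-trans ν₁<ν₂ ν₂≤F
        x₁≡ = f-injective (trans fx₁≡ (sym (map-block-fixes f fixed z<s ν₁<F)))
    in ⊥-elim (<⇒≱ F<x₁ (subst (_≤ F) (sym x₁≡) ν₁<F))
  ... | _ , _ | tri≈ _ ν₁≡ν₂ _ = ν₁≡ν₂
  ... | fixed , eq′ | tri> _ _ ν₂<ν₁ =
    let _ , split = block-++-split ν₂<ν₁ (x₁ ∷ r₁)
        _ , fν₂≡ = map-block-∷ f ν₂ (trans (cong (map f) (sym split)) eq′)
        ν₂<F = <-≤-trans ν₂<ν₁ ν₁≤F
        x₂≡ = trans (sym fν₂≡) (map-block-fixes f fixed z<s ν₂<F)
    in ⊥-elim (<⇒≱ F<x₂ (subst (_≤ F) (sym x₂≡) ν₂<F))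

tailStep : (Word → Word) → ℕ → ℕ → Word → Word
tailStep φ ν m w = take n w ++ u ++ drop n w ++ φ u
  where
    n = length w ∸ m
    u = block (maxSym w) ν

insert-at-tail : ∀ w n (u u′ : Word) →
  y₁ w (n + 1) (length w + 1) ++ u ++ y₂ w (n + 1) (length w + 1) ++ u′ ++ y₃ w (n + 1) (length w + 1)
    ≡ take n w ++ u ++ drop n w ++ u′
insert-at-tail w n u u′
  rewrite m+n∸n≡m n 1 | m+n∸n≡m (length w) 1
        | take-all (length w ∸ n) (drop n w) (≤-reflexive (length-drop n w))
        | drop-all (length w) w ≤-refl
        | ++-identityʳ u′ = refl

module TailInsertion (φ : Word → Word) (length-φ : ∀ u → length (φ u) ≡ length u) (ν m : ℕ) where

  length-tailStep : ∀ w → length (tailStep φ ν m w) ≡ length w + (ν + ν)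
  length-tailStep w = begin
    length (t ++ u ++ d ++ φ u)                    ≡⟨ length-++ t ⟩
    length t + length (u ++ d ++ φ u)              ≡⟨ cong (length t +_) (trans (length-++ u) (cong (length u +_) (length-++ d))) ⟩
    length t + (length u + (length d + length (φ u)))
      ≡⟨ cong (λ k → length t + (length u + (length d + k))) (length-φ u) ⟩
    length t + (length u + (length d + length u))  ≡⟨ interchange (length t) (length u) (length d) ⟩
    (length t + length d) + (length u + length u)  ≡⟨ cong₂ _+_ (trans (sym (length-++ t)) (cong length (take++drop≡id n w)))
                                                                 (cong₂ _+_ (length-block _ ν) (length-block _ ν)) ⟩
    length w + (ν + ν)                             ∎
    where
      n : ℕ
      n = length w ∸ m
      u t d : Word
      u = block (maxSym w) ν
      t = take n w
      d = drop n w
      interchange : ∀ a b c → a + (b + (c + b)) ≡ (a + c) + (b + b)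
      interchange = solve-∀

  tailStep-exact : ∀ (P r : Word) {w M} → w ≡ P ++ r → length P + m ≡ length w → maxSym w ≡ M →
    tailStep φ ν m w ≡ P ++ block M ν ++ r ++ φ (block M ν)
  tailStep-exact P r refl len refl = begin
    take n w ++ u ++ drop n w ++ φ u                       ≡⟨ cong (λ k → take k w ++ u ++ drop k w ++ φ u) n≡ ⟩
    take (length P) w ++ u ++ drop (length P) w ++ φ u     ≡⟨ cong₂ (λ x y → x ++ u ++ y ++ φ u) (take-length-++ P r) (drop-length-++ P r) ⟩
    P ++ u ++ r ++ φ u                                     ∎
    where
      w u : Word
      w = P ++ r
      u = block (maxSym w) ν
      n : ℕ
      n = length w ∸ m
      n≡ : n ≡ length P
      n≡ = trans (cong (_∸ m) (sym len)) (m+n∸n≡m (length P) m)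

  tailStep-prefix : ∀ (P r : Word) {w} → w ≡ P ++ r → length P + m ≤ length w → ∃ λ r′ → tailStep φ ν m w ≡ P ++ r′
  tailStep-prefix P r refl le =
    _ , trans (cong (_++ rest) (take-++-≥ P r (m+n≤o⇒m≤o∸n (length P) le))) (++-assoc P _ rest)
    where
      u rest : Word
      u = block (maxSym (P ++ r)) ν
      rest = u ++ drop (length (P ++ r) ∸ m) (P ++ r) ++ φ u

  tailStep-room : ∀ (P Q : Word) {w} → length P + m ≡ length w → length Q ≤ length P + (ν + ν) →
    length Q + m ≤ length (tailStep φ ν m w)
  tailStep-room P Q {w} len le = ≤-trans (+-monoˡ-≤ m le) (≤-reflexive (begin
    length P + (ν + ν) + m    ≡⟨ +-comm-middle (length P) (ν + ν) m ⟩
    length P + m + (ν + ν)    ≡⟨ cong (_+ (ν + ν)) len ⟩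
    length w + (ν + ν)        ≡⟨ length-tailStep w ⟨
    length (tailStep φ ν m w) ∎))
    where
      +-comm-middle : ∀ a b c → a + b + c ≡ a + c + b
      +-comm-middle = solve-∀

  module Iterate (s : ℕ → Word) (step : ∀ j → s (suc j) ≡ tailStep φ ν m (s j)) where

    length-iterate : length (s 0) ≡ m + m → ∀ j → length (s j) ≡ 2 * (m + j * ν)
    length-iterate len₀ zero    = trans len₀ (double m)
      where
        double : ∀ m → m + m ≡ 2 * (m + 0)
        double = solve-∀
    length-iterate len₀ (suc j) = begin
      length (s (suc j))              ≡⟨ cong length (step j) ⟩
      length (tailStep φ ν m (s j))   ≡⟨ length-tailStep (s j) ⟩
      length (s j) + (ν + ν)          ≡⟨ cong (_+ (ν + ν)) (length-iterate len₀ j) ⟩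
      2 * (m + j * ν) + (ν + ν)       ≡⟨ grow m j ν ⟩
      2 * (m + suc j * ν)             ∎
      where
        grow : ∀ m j ν → 2 * (m + j * ν) + (ν + ν) ≡ 2 * (m + suc j * ν)
        grow = solve-∀

    length-mono : ∀ {j k} → j ≤′ k → length (s j) ≤ length (s k)
    length-mono ≤′-refl              = ≤-refl
    length-mono (≤′-step {k} j≤′k) = ≤-trans (length-mono j≤′k)
      (≤-trans (m≤m+n _ (ν + ν)) (≤-reflexive (sym (trans (cong length (step k)) (length-tailStep (s k))))))

    prefix-persists : ∀ (P r : Word) {j k} → s j ≡ P ++ r → length P + m ≤ length (s j) → j ≤′ k →
      ∃ λ r′ → s k ≡ P ++ r′
    prefix-persists P r eq le ≤′-refl              = r , eq
    prefix-persists P r eq le (≤′-step {k} j≤′k) =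
      let r′ , eq′ = prefix-persists P r eq le j≤′k
          r″ , eq″ = tailStep-prefix P r′ eq′ (≤-trans le (length-mono j≤′k))
      in r″ , trans (step k) eq″

sρ-step : ∀ ν m j → sρ ν m (suc j) ≡ tailStep id ν m (sρ ν m j)
sρ-step ν m j = insert-at-tail s (length s ∸ m) u u
  where
    s u : Word
    s = sρ ν m j
    u = block (maxSym s) ν

module _ (ν m : ℕ) where
  open TailInsertion id (λ _ → refl) ν m
  open Iterate (sρ ν m) (sρ-step ν m)

  length-sρ : ∀ j → length (sρ ν m j) ≡ 2 * (m + j * ν)
  length-sρ = length-iterate (length-block-++-block m m)

  sρ-one : sρ ν m 1 ≡ block 0 (m + ν) ++ block 0 (m + ν)
  sρ-one = begin
    sρ ν m 1                                            ≡⟨ sρ-step ν m 0 ⟩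
    tailStep id ν m (block 0 m ++ block 0 m)            ≡⟨ tailStep-exact (block 0 m) (block 0 m) refl length-s₀ (maxSym-block-++-block m) ⟩
    block 0 m ++ block m ν ++ block 0 m ++ block m ν    ≡⟨ ++-assoc (block 0 m) _ _ ⟨
    (block 0 m ++ block m ν) ++ block 0 m ++ block m ν  ≡⟨ cong₂ _++_ (block-++ 0 m ν) (block-++ 0 m ν) ⟩
    block 0 (m + ν) ++ block 0 (m + ν)                  ∎
    where
      length-s₀ : length (block 0 m) + m ≡ length (block 0 m ++ block 0 m)
      length-s₀ = trans (cong (_+ m) (length-block 0 m)) (sym (length-block-++-block m m))

  private
    P₁ : Word
    P₁ = block 0 (m + ν) ++ block 0 ν

    sρ-one-split : sρ ν m 1 ≡ P₁ ++ block ν m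
    sρ-one-split = begin
      sρ ν m 1                                         ≡⟨ sρ-one ⟩
      block 0 (m + ν) ++ block 0 (m + ν)               ≡⟨ cong (block 0 (m + ν) ++_) (block-+-comm m ν) ⟩
      block 0 (m + ν) ++ block 0 ν ++ block ν m        ≡⟨ ++-assoc (block 0 (m + ν)) (block 0 ν) (block ν m) ⟨
      P₁ ++ block ν m                                  ∎

    length-P₁ : length P₁ + m ≡ length (sρ ν m 1)
    length-P₁ = trans (cong (_+ m) (length-block-++-block (m + ν) ν)) (trans (arith m ν) (sym (length-sρ 1)))
      where
        arith : ∀ m ν → m + ν + ν + m ≡ 2 * (m + 1 * ν)
        arith = solve-∀

  sρ-prefix : ∀ {j} → 1 ≤′ j → ∃ λ r → sρ ν m j ≡ block 0 (m + ν) ++ block 0 ν ++ r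
  sρ-prefix 1≤′j =
    let r , eq = prefix-persists P₁ (block ν m) sρ-one-split (≤-reflexive length-P₁) 1≤′j
    in r , trans eq (++-assoc (block 0 (m + ν)) (block 0 ν) r)

  sρ-prefix-fresh : .{{_ : NonZero ν}} → ∀ {j} → 2 ≤′ j → ∃ λ r → sρ ν m j ≡ block 0 (m + ν) ++ block 0 ν ++ suc (m + ν) ∷ r
  sρ-prefix-fresh {j} 2≤′j =
    let r , eq = prefix-persists P₂ (block ν m ++ u) sρ-two room 2≤′j
        t , u≡ = block-nonempty (m + ν) ν
    in t ++ r , (begin
      sρ ν m j                                     ≡⟨ eq ⟩
      (P₁ ++ u) ++ r                               ≡⟨ ++-assoc P₁ u r ⟩
      P₁ ++ u ++ r                                 ≡⟨ ++-assoc (block 0 (m + ν)) (block 0 ν) (u ++ r) ⟩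
      block 0 (m + ν) ++ block 0 ν ++ u ++ r       ≡⟨ cong (λ v → block 0 (m + ν) ++ block 0 ν ++ v ++ r) u≡ ⟩
      block 0 (m + ν) ++ block 0 ν ++ suc (m + ν) ∷ t ++ r ∎)
    where
      u P₂ : Word
      u = block (m + ν) ν
      P₂ = P₁ ++ u
      maxSym-s₁ : maxSym (sρ ν m 1) ≡ m + ν
      maxSym-s₁ = trans (cong maxSym sρ-one) (maxSym-block-++-block (m + ν))
      sρ-two : sρ ν m 2 ≡ P₂ ++ block ν m ++ u
      sρ-two = trans (sρ-step ν m 1) (trans (tailStep-exact P₁ (block ν m) sρ-one-split length-P₁ maxSym-s₁) (sym (++-assoc P₁ u _)))
      room : length P₂ + m ≤ length (sρ ν m 2)
      room = subst (length P₂ + m ≤_) (cong length (sym (sρ-step ν m 1)))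
        (tailStep-room P₁ P₂ length-P₁
          (≤-trans (≤-reflexive (trans (length-++ P₁ {u}) (cong (length P₁ +_) (length-block (m + ν) ν))))
                   (+-monoʳ-≤ (length P₁) (m≤m+n ν ν))))

tτ-step : ∀ ν .{{_ : NonZero ν}} m j → tτ ν m (suc j) ≡ tailStep reverse ν m (tτ ν m j)
tτ-step ν m j = insert-at-tail t (length t ∸ m) u (reverse u)
  where
    t u : Word
    t = tτ ν m j
    u = block (maxSym t) ν

reversed-blocks-head : ∀ q ν .{{_ : NonZero ν}} →
  ∃ λ r → concat (map reverse (blocksFrom 0 q ν)) ++ reverse (block (q * ν) ν) ≡ ν ∷ r
reversed-blocks-head zero    (suc ν) = reverse (block 0 ν) , reverse-block-suc 0 ν
reversed-blocks-head (suc q) (suc ν) = reverse (block 0 ν) ++ rest ,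
  trans (++-assoc (reverse (block 0 (suc ν))) _ (reverse (block (suc q * suc ν) (suc ν))))
        (cong (_++ rest) (reverse-block-suc 0 ν))
  where
    rest : Word
    rest = concat (map reverse (blocksFrom (suc ν) q (suc ν))) ++ reverse (block (suc q * suc ν) (suc ν))

module _ (ν : ℕ) .{{_ : NonZero ν}} (q : ℕ) where
  open TailInsertion reverse length-reverse ν (q * ν)
  open Iterate (tτ ν (q * ν)) (tτ-step ν (q * ν))

  private
    R : Word
    R = concat (map reverse (blocksFrom 0 q ν))

    tτ-zero : tτ ν (q * ν) 0 ≡ block 0 (q * ν) ++ R
    tτ-zero = trans (cong (λ h → Int h ν) (m*n/n≡m q ν)) (cong (_++ R) (concat-blocksFrom 0 q ν))

    length-t₀ : length (tτ ν (q * ν) 0) ≡ q * ν + q * ν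
    length-t₀ = begin
      length (tτ ν (q * ν) 0)              ≡⟨ cong length tτ-zero ⟩
      length (block 0 (q * ν) ++ R)        ≡⟨ length-++ (block 0 (q * ν)) ⟩
      length (block 0 (q * ν)) + length R  ≡⟨ cong₂ _+_ (length-block 0 (q * ν)) (length-concat-map-reverse (blocksFrom 0 q ν)) ⟩
      q * ν + length (concat (blocksFrom 0 q ν))
        ≡⟨ cong (λ b → q * ν + length b) (concat-blocksFrom 0 q ν) ⟩
      q * ν + length (block 0 (q * ν))     ≡⟨ cong (q * ν +_) (length-block 0 (q * ν)) ⟩
      q * ν + q * ν                        ∎

    maxSym-t₀ : maxSym (tτ ν (q * ν) 0) ≡ q * ν
    maxSym-t₀ = begin
      maxSym (tτ ν (q * ν) 0)              ≡⟨ cong maxSym tτ-zero ⟩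
      maxSym (block 0 (q * ν) ++ R)        ≡⟨ maxSym-++ (block 0 (q * ν)) R ⟩
      maxSym (block 0 (q * ν)) ⊔ maxSym R  ≡⟨ cong (maxSym (block 0 (q * ν)) ⊔_) (maxSym-concat-map-reverse (blocksFrom 0 q ν)) ⟩
      maxSym (block 0 (q * ν)) ⊔ maxSym (concat (blocksFrom 0 q ν))
        ≡⟨ cong₂ _⊔_ (maxSym-block (q * ν)) (trans (cong maxSym (concat-blocksFrom 0 q ν)) (maxSym-block (q * ν))) ⟩
      q * ν ⊔ q * ν                        ≡⟨ ⊔-idem (q * ν) ⟩
      q * ν                                ∎

    split-t₀ : length (block 0 (q * ν)) + q * ν ≡ length (tτ ν (q * ν) 0)
    split-t₀ = trans (cong (_+ q * ν) (length-block 0 (q * ν))) (sym length-t₀)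

    Q : Word
    Q = block 0 (q * ν + ν) ++ ν ∷ []

    tτ-one : ∃ λ r → tτ ν (q * ν) 1 ≡ Q ++ r
    tτ-one =
      let r , head≡ = reversed-blocks-head q ν
      in r , (begin
        tτ ν (q * ν) 1                              ≡⟨ tτ-step ν (q * ν) 0 ⟩
        tailStep reverse ν (q * ν) (tτ ν (q * ν) 0) ≡⟨ tailStep-exact (block 0 (q * ν)) R tτ-zero split-t₀ maxSym-t₀ ⟩
        block 0 (q * ν) ++ u ++ R ++ reverse u      ≡⟨ ++-assoc (block 0 (q * ν)) u _ ⟨
        (block 0 (q * ν) ++ u) ++ R ++ reverse u    ≡⟨ cong₂ _++_ (block-++ 0 (q * ν) ν) head≡ ⟩
        block 0 (q * ν + ν) ++ ν ∷ r                ≡⟨ ++-assoc (block 0 (q * ν + ν)) (ν ∷ []) r ⟨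
        Q ++ r                                      ∎)
      where
        u : Word
        u = block (q * ν) ν

    length-Q : length Q ≡ q * ν + (ν + 1)
    length-Q = begin
      length Q                             ≡⟨ length-++ (block 0 (q * ν + ν)) ⟩
      length (block 0 (q * ν + ν)) + 1     ≡⟨ cong (_+ 1) (length-block 0 (q * ν + ν)) ⟩
      q * ν + ν + 1                        ≡⟨ +-assoc (q * ν) ν 1 ⟩
      q * ν + (ν + 1)                      ∎

    room : length Q + q * ν ≤ length (tτ ν (q * ν) 1)
    room = subst (length Q + q * ν ≤_) (cong length (sym (tτ-step ν (q * ν) 0)))
      (tailStep-room (block 0 (q * ν)) Q split-t₀
        (subst₂ _≤_ (sym length-Q) (cong (_+ (ν + ν)) (sym (length-block 0 (q * ν))))
          (+-monoʳ-≤ (q * ν) (+-monoʳ-≤ ν (>-nonZero⁻¹ ν)))))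

  length-tτ : ∀ j → length (tτ ν (q * ν) j) ≡ 2 * (q * ν + j * ν)
  length-tτ = length-iterate length-t₀

  tτ-prefix : ∀ {j} → 1 ≤′ j → ∃ λ r → tτ ν (q * ν) j ≡ block 0 (q * ν + ν) ++ ν ∷ r
  tτ-prefix 1≤′j =
    let r₁ , e₁ = tτ-one
        r , eq = prefix-persists Q r₁ e₁ room 1≤′j
    in r , trans eq (++-assoc (block 0 (q * ν + ν)) (ν ∷ []) r)

parameters-determined : ∀ {ν₁ ν₂ m₁ m₂ j₁ j₂} .{{_ : NonZero ν₁}} → ν₁ ≡ ν₂ → m₁ + ν₁ ≡ m₂ + ν₂ →
  m₁ + j₁ * ν₁ ≡ m₂ + j₂ * ν₂ → ν₁ ≡ ν₂ × m₁ ≡ m₂ × j₁ ≡ j₂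
parameters-determined {ν} {_} {m₁} {m₂} {j₁} {j₂} refl F-eq weight-eq =
  refl , m-eq , *-cancelʳ-≡ j₁ j₂ ν (+-cancelˡ-≡ m₁ _ _ (trans weight-eq (cong (_+ j₂ * ν) (sym m-eq))))
  where
    m-eq : m₁ ≡ m₂
    m-eq = +-cancelʳ-≡ ν m₁ m₂ F-eq

tangledρ-rigid : (ν₁ ν₂ m₁ m₂ j₁ j₂ : ℕ) → 1 ≤ ν₁ → 1 ≤ ν₂ → 1 ≤ j₁ → 1 ≤ j₂ →
  Tρ ν₁ m₁ j₁ ∼ Tρ ν₂ m₂ j₂ → 1 < j₁ → ν₁ ≡ ν₂ × m₁ ≡ m₂ × j₁ ≡ j₂
tangledρ-rigid ν₁ ν₂ m₁ m₂ j₁ j₂ 1≤ν₁@(s≤s z≤n) 1≤ν₂@(s≤s z≤n) 1≤j₁ 1≤j₂ (f , eq) 1<j₁ =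
  [ later-insertion , single-insertion ]′ (m≤n⇒m<n∨m≡n 1≤j₂)
  where
    relabel : ∀ {w₁ w₂} → sρ ν₁ m₁ j₁ ≡ w₁ → sρ ν₂ m₂ j₂ ≡ w₂ → map (Bijection.to f) w₁ ≡ w₂
    relabel e₁ e₂ = subst₂ (λ w v → map (Bijection.to f) w ≡ v) e₁ e₂ eq

    F-eq : m₁ + ν₁ ≡ m₂ + ν₂
    F-eq = proj₁ (block-then-repeat-unique (Bijection.injective f)
      z<s (≤-trans 1≤ν₁ (m≤n+m ν₁ m₁)) z<s (≤-trans 1≤ν₂ (m≤n+m ν₂ m₂))
      (relabel (proj₂ (sρ-prefix ν₁ m₁ (≤⇒≤′ 1≤j₁))) (proj₂ (sρ-prefix ν₂ m₂ (≤⇒≤′ 1≤j₂)))))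

    weight-eq : m₁ + j₁ * ν₁ ≡ m₂ + j₂ * ν₂
    weight-eq = *-cancelˡ-≡ _ _ 2
      (trans (sym (length-sρ ν₁ m₁ j₁)) (trans (map-≡⇒length-≡ _ eq) (length-sρ ν₂ m₂ j₂)))

    later-insertion : 1 < j₂ → ν₁ ≡ ν₂ × m₁ ≡ m₂ × j₁ ≡ j₂
    later-insertion 1<j₂ = parameters-determined ν-eq F-eq weight-eq
      where
        ν-eq : ν₁ ≡ ν₂
        ν-eq = block-then-fresh-unique (Bijection.injective f) F-eq (m≤n+m ν₁ m₁) (m≤n+m ν₂ m₂) (n<1+n _) (n<1+n _)
          (relabel (proj₂ (sρ-prefix-fresh ν₁ m₁ (≤⇒≤′ 1<j₁))) (proj₂ (sρ-prefix-fresh ν₂ m₂ (≤⇒≤′ 1<j₂))))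

    single-insertion : 1 ≡ j₂ → ν₁ ≡ ν₂ × m₁ ≡ m₂ × j₁ ≡ j₂
    single-insertion 1≡j₂ = ⊥-elim (<-irrefl (sym j₁≡1) 1<j₁)
      where
        j₁≡1 : j₁ ≡ 1
        j₁≡1 = *-cancelʳ-≡ j₁ 1 ν₁ (+-cancelˡ-≡ m₁ _ _ (begin
          m₁ + j₁ * ν₁  ≡⟨ weight-eq ⟩
          m₂ + j₂ * ν₂  ≡⟨ cong (λ j → m₂ + j * ν₂) (sym 1≡j₂) ⟩
          m₂ + 1 * ν₂   ≡⟨ cong (m₂ +_) (*-identityˡ ν₂) ⟩
          m₂ + ν₂       ≡⟨ F-eq ⟨
          m₁ + ν₁       ≡⟨ cong (m₁ +_) (*-identityˡ ν₁) ⟨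
          m₁ + 1 * ν₁   ∎))

tangledτ-rigid : (ν₁ ν₂ m₁ m₂ j₁ j₂ : ℕ) → .{{_ : NonZero ν₁}} → .{{_ : NonZero ν₂}} → 1 ≤ j₁ → 1 ≤ j₂ →
  ν₁ ∣ m₁ → ν₂ ∣ m₂ → Tτ ν₁ m₁ j₁ ∼ Tτ ν₂ m₂ j₂ → ν₁ ≡ ν₂ × m₁ ≡ m₂ × j₁ ≡ j₂
tangledτ-rigid ν₁ ν₂ _ _ j₁ j₂ 1≤j₁ 1≤j₂ (divides q₁ refl) (divides q₂ refl) (f , eq) =
  parameters-determined (proj₂ prefixes-eq) (proj₁ prefixes-eq) weight-eq
  where
    prefixes-eq : q₁ * ν₁ + ν₁ ≡ q₂ * ν₂ + ν₂ × ν₁ ≡ ν₂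
    prefixes-eq = block-then-repeat-unique (Bijection.injective f)
      (>-nonZero⁻¹ ν₁) (m≤n+m ν₁ (q₁ * ν₁)) (>-nonZero⁻¹ ν₂) (m≤n+m ν₂ (q₂ * ν₂))
      (subst₂ (λ w v → map (Bijection.to f) w ≡ v)
        (proj₂ (tτ-prefix ν₁ q₁ (≤⇒≤′ 1≤j₁))) (proj₂ (tτ-prefix ν₂ q₂ (≤⇒≤′ 1≤j₂))) eq)

    weight-eq : q₁ * ν₁ + j₁ * ν₁ ≡ q₂ * ν₂ + j₂ * ν₂
    weight-eq = *-cancelˡ-≡ _ _ 2
      (trans (sym (length-tτ ν₁ q₁ j₁)) (trans (map-≡⇒length-≡ _ eq) (length-tτ ν₂ q₂ j₂)))

proposition3p16 :
    ((ν₁ ν₂ m₁ m₂ j₁ j₂ : ℕ) → 1 ≤ ν₁ → 1 ≤ ν₂ → 1 ≤ j₁ → 1 ≤ j₂ →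
      Tρ ν₁ m₁ j₁ ∼ Tρ ν₂ m₂ j₂ → 1 < j₁ →
      (ν₁ ≡ ν₂ × m₁ ≡ m₂ × j₁ ≡ j₂))
    ×
    ((ν₁ ν₂ m₁ m₂ j₁ j₂ : ℕ) → .{{_ : NonZero ν₁}} → .{{_ : NonZero ν₂}} → 1 ≤ j₁ → 1 ≤ j₂ →
      ν₁ ∣ m₁ → ν₂ ∣ m₂ →
      Tτ ν₁ m₁ j₁ ∼ Tτ ν₂ m₂ j₂ →
      (ν₁ ≡ ν₂ × m₁ ≡ m₂ × j₁ ≡ j₂))
proposition3p16 = tangledρ-rigid , tangledτ-rigid
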